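{- Let $X\subseteq B^n$ and let $c$ be a partial sorting network on $X$. Then for every prunable channel $i\in p(X)$, the pruned comparator network $c/i$ is a partial sorting network on $X/i$.
   Context: $B=\{0,1\}$. A comparator $[i,j]$ replaces $x_i$ by $\min(x_i,x_j)$ and $x_j$ by $\max(x_i,x_j)$; an exchange $(i,j)$ swaps entries $i,j$. A comparator network is a finite sequence of comparators and exchanges applied left to right. For $X\subseteq B^n$, a partial sorting network on $X$ is a comparator network on $n$ channels whose output on every $x\in X$ is sorted (nondecreasing). For $x\in B^n$, $x/i\in B^{n-1}$ is $x$ with entry $i$ deleted, and $X/i=\{x/i\mid x\in X,\ x_i=1\}$. The one-hot sequence $e^{(i,n)}\in B^n$ has a $1$ exactly at position $i$; channel $i$ is prunable for $X$ if $e^{(i,n)}\in X$, and $p(X)$ is the set of prunable channels. Every comparator network corresponds to a comparator circuit: $n$ ordered inputs and outputs, built from comparator gates (two unlabeled inputs, outputs labeled min and max), acyclic, each port connected to exactly one other; exchanges are absorbed in the wiring, and conversely every such circuit is realized by a comparator network with the same input-output behaviour. Pruning: in the circuit of $c$, follow the path from input $i$ that leaves every gate it enters via the max output, ending at an output $j$. Delete the wires of this path; each gate on it now has one incoming and one outgoing wire, and is removed and replaced by a wire joining those two ports. Delete the isolated input $i$ and output $j$, keeping the order of the remaining inputs and outputs. The resulting circuit on $n-1$ channels, viewed as a comparator network, is $c/i$. -}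

module Defs where

open import Data.Bool using (Bool; true; false; _∧_; _∨_)
import Data.Bool as Bool
open import Data.Nat using (ℕ; zero; suc)
open import Data.Fin using (Fin; zero; suc; punchOut; _≟_)
import Data.Fin as Fin
open import Data.Fin.Properties using (suc-injective; punchOut-injective)
open import Data.Vec using (Vec; lookup; tabulate; removeAt; _[_]≔_)
open import Data.List using (List; []; _∷_; _++_; map; foldl)
open import Data.Product using (∃; _×_)
open import Relation.Nullary using (yes; no; does)
open import Relation.Binary.PropositionalEquality using (_≡_; _≢_; refl; sym)
open import Relation.Unary using (Pred)
open import Level using (0ℓ)

data Gate (n : ℕ) : Set where
  cmp  : (i j : Fin n) → i ≢ j → Gate n
  exch : (i j : Fin n) → Gate n

Network : ℕ → Set
Network n = List (Gate n)

-- Semantics on B^n (false < true, min = ∧, max = ∨).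
applyGate : ∀ {n} → Gate n → Vec Bool n → Vec Bool n
applyGate (cmp i j _) x = (x [ i ]≔ (lookup x i ∧ lookup x j)) [ j ]≔ (lookup x i ∨ lookup x j)
applyGate (exch i j)  x = (x [ i ]≔ lookup x j) [ j ]≔ lookup x i

run : ∀ {n} → Network n → Vec Bool n → Vec Bool n
run c x = foldl (λ v g → applyGate g v) x c

Sorted : ∀ {n} → Vec Bool n → Set
Sorted x = ∀ i j → i Fin.≤ j → lookup x i Bool.≤ lookup x j

PartialSorting : ∀ {n} → Pred (Vec Bool n) 0ℓ → Network n → Set
PartialSorting X c = ∀ x → X x → Sorted (run c x)

oneHot : ∀ {n} → Fin n → Vec Bool n
oneHot i = tabulate (λ j → does (j ≟ i))

Prunable : ∀ {n} → Pred (Vec Bool n) 0ℓ → Fin n → Set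
Prunable X i = X (oneHot i)

_/ᵥ_ : ∀ {n} → Pred (Vec Bool (suc n)) 0ℓ → Fin (suc n) → Pred (Vec Bool n) 0ℓ
(X /ᵥ i) y = ∃ λ x → X x × lookup x i ≡ true × removeAt x i ≡ y

-- Following the circuit of c from input k along max outputs is the same as
-- tracking a "token" channel through the network: an exchange touching the
-- token channel moves it, a comparator [a,b] touching it sends it to b (max
-- output). Deleting the path and splicing out the gates on it turns each such
-- comparator into the wiring that moves the other input to the min output,
-- i.e. (on the remaining channels) the same re-wiring as exchanging the token.
-- Gates not touching the token are kept (renumbered by deleting the token
-- channel); re-wirings are realized by sequences of adjacent exchanges.

liftG : ∀ {n} → Gate n → Gate (suc n)
liftG (cmp i j p) = cmp (suc i) (suc j) (λ e → p (suc-injective e))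
liftG (exch i j)  = exch (suc i) (suc j)

rotDown : ∀ {n} → Fin n → Network n
rotDown {suc n} zero = []
rotDown {suc (suc n)} (suc b) = map liftG (rotDown b) ++ (exch zero (suc zero) ∷ [])

rotUp : ∀ {n} → Fin n → Network n
rotUp {suc n} zero = []
rotUp {suc (suc n)} (suc k) = exch zero (suc zero) ∷ map liftG (rotUp k)

-- effect on the n remaining channels of moving the deleted (token) channel
-- from position k to position b of the n+1 channels, the element at b going to k
move : ∀ {n} → Fin (suc n) → Fin (suc n) → Network n
move zero zero = []
move zero (suc b) = rotDown b
move (suc k) zero = rotUp k
move {suc n} (suc k) (suc b) = map liftG (move k b)

-- prune k c : the network c/k, with the token currently at channel k
prune : ∀ {n} → Fin (suc n) → Network (suc n) → Network n
prune k [] = []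
prune k (cmp a b p ∷ gs) with a ≟ k | b ≟ k
... | yes _ | _     = move k b ++ prune b gs
... | no _  | yes _ = prune k gs
... | no a≢k | no b≢k =
  cmp (punchOut (λ e → a≢k (sym e))) (punchOut (λ e → b≢k (sym e)))
      (λ e → p (punchOut-injective (λ e′ → a≢k (sym e′)) (λ e′ → b≢k (sym e′)) e))
    ∷ prune k gs
prune k (exch a b ∷ gs) with a ≟ k | b ≟ k
... | yes _ | _     = move k b ++ prune b gs
... | no _  | yes _ = move k a ++ prune a gs
... | no a≢k | no b≢k =
  exch (punchOut (λ e → a≢k (sym e))) (punchOut (λ e → b≢k (sym e))) ∷ prune k gs

_/ₙ_ : ∀ {n} → Network (suc n) → Fin (suc n) → Network n
c /ₙ i = prune i c

module Submission where

-- On an input x with xᵢ = 1, the path leaving every gate by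
-- its max output starts at input i and carries the value 1 throughout, since
-- max(1, y) = 1; every comparator on it passes its other input y unchanged to
-- its min output, since min(1, y) = y.  Splicing these gates out therefore
-- computes, on x/i, exactly the output of c on x with the entry at the end of
-- the path deleted, and deleting an entry of a sorted vector keeps it sorted.

open import Defs
open import Data.Nat using (ℕ; suc)
open import Data.Fin using (Fin; zero; suc; punchIn; punchOut; _≟_)
open import Data.Fin.Properties using (punchIn-mono-≤)
open import Data.Bool using (Bool; true; _∧_; _∨_)
open import Data.Bool.Properties using (∧-identityʳ; ∨-zeroʳ)
open import Data.Vec using (Vec; _∷_; lookup; removeAt; insertAt; _[_]≔_)
open import Data.Vec.Properties
  using ( []≔-commutes; []≔-lookup; lookup∘update; lookup∘update′
        ; removeAt-punchOut; insertAt-removeAt)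
open import Data.List using ([]; _∷_; _++_; map)
open import Data.List.Properties using (foldl-++)
open import Data.Product using (∃; _,_)
open import Relation.Nullary using (yes; no)
open import Relation.Unary using (Pred)
open import Relation.Binary.PropositionalEquality
open import Level using (0ℓ)
open import Function using (_∘′_)
open ≡-Reasoning

module _ {A : Set} where

  removeAt-punchIn : ∀ {n} (v : Vec A (suc n)) k j →
                     lookup (removeAt v k) j ≡ lookup v (punchIn k j)
  removeAt-punchIn (x ∷ v)     zero    j       = refl
  removeAt-punchIn (x ∷ y ∷ v) (suc k) zero    = refl
  removeAt-punchIn (x ∷ y ∷ v) (suc k) (suc j) = removeAt-punchIn (y ∷ v) k j

  removeAt-suc : ∀ {n} x (v : Vec A (suc n)) k → removeAt (x ∷ v) (suc k) ≡ x ∷ removeAt v k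
  removeAt-suc x (y ∷ v) k = refl

  removeAt-update-same : ∀ {n} (v : Vec A (suc n)) k x → removeAt (v [ k ]≔ x) k ≡ removeAt v k
  removeAt-update-same (y ∷ v)     zero    x = refl
  removeAt-update-same (y ∷ z ∷ v) (suc k) x =
    trans (removeAt-suc y ((z ∷ v) [ k ]≔ x) k)
          (cong (y ∷_) (removeAt-update-same (z ∷ v) k x))

  removeAt-update : ∀ {n} (v : Vec A (suc n)) {k a} (k≢a : k ≢ a) x →
                    removeAt (v [ a ]≔ x) k ≡ removeAt v k [ punchOut k≢a ]≔ x
  removeAt-update (y ∷ v)     {zero}  {zero}  k≢a x with () ← k≢a refl
  removeAt-update (y ∷ v)     {zero}  {suc a} k≢a x = refl
  removeAt-update (y ∷ z ∷ v) {suc k} {zero}  k≢a x = refl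
  removeAt-update (y ∷ z ∷ v) {suc k} {suc a} k≢a x =
    trans (removeAt-suc y ((z ∷ v) [ a ]≔ x) k)
          (cong (y ∷_) (removeAt-update (z ∷ v) (k≢a ∘′ cong suc) x))

  insertAt-removeAt-update : ∀ {n} (v : Vec A (suc n)) k x →
                             insertAt (removeAt v k) k x ≡ v [ k ]≔ x
  insertAt-removeAt-update v k x = begin
    insertAt (removeAt v k) k x
      ≡⟨ cong (λ w → insertAt w k x) (removeAt-update-same v k x) ⟨
    insertAt (removeAt (v [ k ]≔ x) k) k x
      ≡⟨ cong (insertAt _ k) (lookup∘update k v x) ⟨
    insertAt (removeAt (v [ k ]≔ x) k) k (lookup (v [ k ]≔ x) k)
      ≡⟨ insertAt-removeAt (v [ k ]≔ x) k ⟩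
    v [ k ]≔ x
      ∎

  removeAt-update₂ : ∀ {n} (v : Vec A (suc n)) {k a b} (k≢a : k ≢ a) (k≢b : k ≢ b)
                     (f g : A → A → A) →
    let w = removeAt v k; a′ = punchOut k≢a; b′ = punchOut k≢b in
    removeAt ((v [ a ]≔ f (lookup v a) (lookup v b)) [ b ]≔ g (lookup v a) (lookup v b)) k ≡
    (w [ a′ ]≔ f (lookup w a′) (lookup w b′)) [ b′ ]≔ g (lookup w a′) (lookup w b′)
  removeAt-update₂ v {k} {a} {b} k≢a k≢b f g = begin
    removeAt ((v [ a ]≔ f x y) [ b ]≔ g x y) k
      ≡⟨ removeAt-update (v [ a ]≔ f x y) k≢b (g x y) ⟩
    removeAt (v [ a ]≔ f x y) k [ b′ ]≔ g x y
      ≡⟨ cong (_[ b′ ]≔ g x y) (removeAt-update v k≢a (f x y)) ⟩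
    (w [ a′ ]≔ f x y) [ b′ ]≔ g x y
      ≡⟨ cong₂ (λ x y → (w [ a′ ]≔ f x y) [ b′ ]≔ g x y)
               (removeAt-punchOut v k≢a) (removeAt-punchOut v k≢b) ⟨
    (w [ a′ ]≔ f (lookup w a′) (lookup w b′)) [ b′ ]≔ g (lookup w a′) (lookup w b′)
      ∎
    where
    x = lookup v a
    y = lookup v b
    w = removeAt v k
    a′ = punchOut k≢a
    b′ = punchOut k≢b

  lookup-update₂-other : ∀ {n} (v : Vec A n) {k a b} → k ≢ a → k ≢ b → ∀ x y →
                         lookup ((v [ a ]≔ x) [ b ]≔ y) k ≡ lookup v k
  lookup-update₂-other v {a = a} k≢a k≢b x y =
    trans (lookup∘update′ k≢b (v [ a ]≔ x) y) (lookup∘update′ k≢a v x)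

Sorted-removeAt : ∀ {n} (v : Vec Bool (suc n)) k → Sorted v → Sorted (removeAt v k)
Sorted-removeAt v k sorted i j i≤j
  rewrite removeAt-punchIn v k i | removeAt-punchIn v k j = sorted _ _ (punchIn-mono-≤ k i j i≤j)

run-++ : ∀ {n} (c d : Network n) v → run (c ++ d) v ≡ run d (run c v)
run-++ c d v = foldl-++ _ v c d

run-map-liftG : ∀ {n} (c : Network n) x v → run (map liftG c) (x ∷ v) ≡ x ∷ run c v
run-map-liftG []              x v = refl
run-map-liftG (cmp i j _ ∷ c) x v = run-map-liftG c x _
run-map-liftG (exch i j ∷ c)  x v = run-map-liftG c x _

run-rotDown : ∀ {n} (b : Fin (suc n)) v → run (rotDown b) v ≡ lookup v b ∷ removeAt v b
run-rotDown           zero    (x ∷ v)     = refl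
run-rotDown {suc n}   (suc b) (x ∷ y ∷ v) = begin
  run (map liftG (rotDown b) ++ exch zero (suc zero) ∷ []) (x ∷ y ∷ v)
    ≡⟨ run-++ (map liftG (rotDown b)) _ (x ∷ y ∷ v) ⟩
  applyGate (exch zero (suc zero)) (run (map liftG (rotDown b)) (x ∷ y ∷ v))
    ≡⟨ cong (applyGate (exch zero (suc zero))) (run-map-liftG (rotDown b) x (y ∷ v)) ⟩
  applyGate (exch zero (suc zero)) (x ∷ run (rotDown b) (y ∷ v))
    ≡⟨ cong (λ w → applyGate (exch zero (suc zero)) (x ∷ w)) (run-rotDown b (y ∷ v)) ⟩
  lookup (y ∷ v) b ∷ x ∷ removeAt (y ∷ v) b
    ∎

run-rotUp : ∀ {n} (k : Fin (suc n)) x v → run (rotUp k) (x ∷ v) ≡ insertAt v k x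
run-rotUp         zero    x v       = refl
run-rotUp {suc n} (suc k) x (y ∷ v) =
  trans (run-map-liftG (rotUp k) y (x ∷ v)) (cong (y ∷_) (run-rotUp k x v))

run-move : ∀ {n} (v : Vec Bool (suc n)) k b →
           run (move k b) (removeAt v k) ≡ removeAt (v [ k ]≔ lookup v b) b
run-move         (x ∷ u) zero    zero    = refl
run-move {suc n} (x ∷ u) zero    (suc b) = trans (run-rotDown b u) (sym (removeAt-suc (lookup u b) u b))
run-move {suc n} (x ∷ u) (suc k) zero    = begin
  run (rotUp k) (removeAt (x ∷ u) (suc k)) ≡⟨ cong (run (rotUp k)) (removeAt-suc x u k) ⟩
  run (rotUp k) (x ∷ removeAt u k)         ≡⟨ run-rotUp k x (removeAt u k) ⟩
  insertAt (removeAt u k) k x              ≡⟨ insertAt-removeAt-update u k x ⟩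
  u [ k ]≔ x                               ∎
run-move {suc n} (x ∷ u) (suc k) (suc b) = begin
  run (map liftG (move k b)) (removeAt (x ∷ u) (suc k))
    ≡⟨ cong (run (map liftG (move k b))) (removeAt-suc x u k) ⟩
  run (map liftG (move k b)) (x ∷ removeAt u k)
    ≡⟨ run-map-liftG (move k b) x (removeAt u k) ⟩
  x ∷ run (move k b) (removeAt u k)
    ≡⟨ cong (x ∷_) (run-move u k b) ⟩
  x ∷ removeAt (u [ k ]≔ lookup u b) b
    ≡⟨ removeAt-suc x (u [ k ]≔ lookup u b) b ⟨
  removeAt (x ∷ (u [ k ]≔ lookup u b)) (suc b)
    ∎

run-move-token : ∀ {n} (v : Vec Bool (suc n)) k b t →
                 run (move k b) (removeAt v k) ≡ removeAt ((v [ k ]≔ lookup v b) [ b ]≔ t) b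
run-move-token v k b t = trans (run-move v k b) (sym (removeAt-update-same (v [ k ]≔ lookup v b) b t))

cmp-max-true : ∀ {n} (v : Vec Bool n) {a b} (a≢b : a ≢ b) →
               lookup v b ≡ true → applyGate (cmp a b a≢b) v ≡ v
cmp-max-true v {a} {b} _ vb≡1 = begin
  (v [ a ]≔ (lookup v a ∧ lookup v b)) [ b ]≔ (lookup v a ∨ lookup v b)
    ≡⟨ cong (λ y → (v [ a ]≔ (lookup v a ∧ y)) [ b ]≔ (lookup v a ∨ y)) vb≡1 ⟩
  (v [ a ]≔ (lookup v a ∧ true)) [ b ]≔ (lookup v a ∨ true)
    ≡⟨ cong₂ (λ x y → (v [ a ]≔ x) [ b ]≔ y)
             (∧-identityʳ (lookup v a)) (∨-zeroʳ (lookup v a)) ⟩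
  (v [ a ]≔ lookup v a) [ b ]≔ true
    ≡⟨ cong₂ _[ b ]≔_ ([]≔-lookup v a) (sym vb≡1) ⟩
  v [ b ]≔ lookup v b
    ≡⟨ []≔-lookup v b ⟩
  v ∎

record TokenStep {n} (g : Gate (suc n)) (gs : Network (suc n)) (k : Fin (suc n))
                 (v : Vec Bool (suc n)) (pruned : Network n) : Set where
  field
    next          : Fin (suc n)
    emitted       : Network n
    pruned-≡      : pruned ≡ emitted ++ prune next gs
    next-true     : lookup (applyGate g v) next ≡ true
    removeAt-next : removeAt (applyGate g v) next ≡ run emitted (removeAt v k)

-- The last index makes prune k (g ∷ gs) appear in the goal, so that the
-- with-abstractions below reduce it.
tokenStep : ∀ {n} (g : Gate (suc n)) gs k v → lookup v k ≡ true →
            TokenStep g gs k v (prune k (g ∷ gs))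
tokenStep (cmp a b a≢b) gs k v vk≡1 with a ≟ k | b ≟ k
... | yes refl | _ = record
  { next = b ; emitted = move a b ; pruned-≡ = refl
  ; next-true     = trans (lookup∘update b (v [ a ]≔ (lookup v a ∧ lookup v b)) _)
                          (cong (_∨ lookup v b) vk≡1)
  ; removeAt-next = begin
      removeAt ((v [ a ]≔ (lookup v a ∧ lookup v b)) [ b ]≔ (lookup v a ∨ lookup v b)) b
        ≡⟨ removeAt-update-same (v [ a ]≔ (lookup v a ∧ lookup v b)) b _ ⟩
      removeAt (v [ a ]≔ (lookup v a ∧ lookup v b)) b
        ≡⟨ cong (λ x → removeAt (v [ a ]≔ (x ∧ lookup v b)) b) vk≡1 ⟩
      removeAt (v [ a ]≔ lookup v b) b
        ≡⟨ run-move v a b ⟨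
      run (move a b) (removeAt v a)
        ∎
  }
... | no _ | yes refl = record
  { next = b ; emitted = [] ; pruned-≡ = refl
  ; next-true     = trans (cong (λ w → lookup w b) (cmp-max-true v a≢b vk≡1)) vk≡1
  ; removeAt-next = cong (λ w → removeAt w b) (cmp-max-true v a≢b vk≡1)
  }
... | no a≢k | no b≢k = record
  { next = k ; emitted = _ ∷ [] ; pruned-≡ = refl
  ; next-true     = trans (lookup-update₂-other v (≢-sym a≢k) (≢-sym b≢k) _ _) vk≡1
  ; removeAt-next = removeAt-update₂ v (≢-sym a≢k) (≢-sym b≢k) _∧_ _∨_
  }
tokenStep (exch a b) gs k v vk≡1 with a ≟ k | b ≟ k
... | yes refl | _ = record
  { next = b ; emitted = move a b ; pruned-≡ = refl
  ; next-true     = trans (lookup∘update b (v [ a ]≔ lookup v b) _) vk≡1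
  ; removeAt-next = sym (run-move-token v a b (lookup v a))
  }
... | no a≢b | yes refl = record
  { next = a ; emitted = move b a ; pruned-≡ = refl
  ; next-true     = trans (cong (λ w → lookup w a) swapped)
                          (trans (lookup∘update a (v [ b ]≔ lookup v a) _) vk≡1)
  ; removeAt-next = sym (trans (run-move-token v b a (lookup v b))
                               (cong (λ w → removeAt w a) (sym swapped)))
  }
  where
  swapped : (v [ a ]≔ lookup v b) [ b ]≔ lookup v a ≡ (v [ b ]≔ lookup v a) [ a ]≔ lookup v b
  swapped = []≔-commutes v a b a≢b
... | no a≢k | no b≢k = record
  { next = k ; emitted = _ ∷ [] ; pruned-≡ = refl
  ; next-true     = trans (lookup-update₂-other v (≢-sym a≢k) (≢-sym b≢k) _ _) vk≡1
  ; removeAt-next = removeAt-update₂ v (≢-sym a≢k) (≢-sym b≢k) (λ _ y → y) (λ x _ → x)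
  }

run-prune : ∀ {n} (c : Network (suc n)) k v → lookup v k ≡ true →
            ∃ λ k′ → removeAt (run c v) k′ ≡ run (prune k c) (removeAt v k)
run-prune []       k v _    = k , refl
run-prune (g ∷ gs) k v vk≡1 with tokenStep g gs k v vk≡1
... | record { next = k₁ ; emitted = d ; pruned-≡ = pruned-≡
             ; next-true = vk₁≡1 ; removeAt-next = removeAt-next }
  with run-prune gs k₁ (applyGate g v) vk₁≡1
... | k′ , ih = k′ , (begin
  removeAt (run gs (applyGate g v)) k′
    ≡⟨ ih ⟩
  run (prune k₁ gs) (removeAt (applyGate g v) k₁)
    ≡⟨ cong (run (prune k₁ gs)) removeAt-next ⟩
  run (prune k₁ gs) (run d (removeAt v k))
    ≡⟨ run-++ d (prune k₁ gs) (removeAt v k) ⟨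
  run (d ++ prune k₁ gs) (removeAt v k)
    ≡⟨ cong (λ c → run c (removeAt v k)) pruned-≡ ⟨
  run (prune k (g ∷ gs)) (removeAt v k)
    ∎)

mainTheorem9 : (n : ℕ) (X : Pred (Vec Bool (suc n)) 0ℓ) (c : Network (suc n)) →
    PartialSorting X c →
    (i : Fin (suc n)) → Prunable X i →
    PartialSorting (X /ᵥ i) (c /ₙ i)
mainTheorem9 n X c sorts i _ _ (x , x∈X , xᵢ≡1 , refl) with run-prune c i x xᵢ≡1
... | k , removeAt-run≡run-prune =
  subst Sorted removeAt-run≡run-prune (Sorted-removeAt (run c x) k (sorts x x∈X))
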